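{- Let $n \geq 1$. Approval ballot triangles of size $n$ are in bijection with nests of non-crossing lattice paths of size $n$.
   Context: An approval ballot triangle (ABT) of size $n$ is a triangular array $A(i,j)$, $1 \leq j \leq i \leq n$, with entries in $\{0,1\}$ such that $\sum_{k=j}^{i} A(i,k) \leq \sum_{k=j}^{i+1} A(i+1,k)$ for all $1 \leq j \leq i \leq n-1$. A nest of non-crossing lattice paths (NCLP) of size $n$ is a sequence of lattice paths $Q_1,\dots,Q_n$ in $\mathbb{Z}^2$, using only east steps $(1,0)$ and north steps $(0,1)$, where $Q_i$ starts at $(n+1-i,1)$ and ends on the diagonal $D = \{(n+2-j,j) : 1 \leq j \leq n+1\}$, such that the paths are pairwise non-crossing: for $1 \leq i < j \leq n$, $Q_i$ lies weakly southeast of $Q_j$, meaning that whenever $(x,y)$ is a point of $Q_i$ and $(x',y')$ is a point of $Q_j$ with $x+y = x'+y'$, we have $x' \leq x$ (the paths may share points and steps but may not cross). -}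

module Defs where

open import Data.Nat using (ℕ; zero; suc; _+_; _∸_; _≤_; _<_)
open import Data.Bool using (Bool; true; false)
open import Data.Unit using (⊤)
open import Data.Product using (_×_; _,_; proj₁; proj₂; Σ)
open import Data.List using (List; []; _∷_; map; drop)
open import Data.Nat.ListAction using (sum)
open import Data.List.Membership.Propositional using (_∈_)
open import Data.Vec using (Vec; toList; lookup)
open import Data.Fin using (Fin; toℕ)
open import Data.Refinement using (Refinement; Refinement-syntax)
open import Relation.Binary.PropositionalEquality using (_≡_)

b2n : Bool → ℕ
b2n true  = 1
b2n false = 0

-- In a row  r : Vec Bool i  the
-- entry A(i,k) (1 ≤ k ≤ i) is the element at (1-based) position k.
Tri : ℕ → Set
Tri zero    = ⊤
Tri (suc n) = Tri n × Vec Bool (suc n)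

sumFrom : ∀ {i} → ℕ → Vec Bool i → ℕ
sumFrom j r = sum (drop (j ∸ 1) (map b2n (toList r)))

RowCond : ∀ {i} → Vec Bool i → Vec Bool (suc i) → Set
RowCond {i} r r' = (j : ℕ) → 1 ≤ j → j ≤ i → sumFrom j r ≤ sumFrom j r'

IsABT : ∀ {n} → Tri n → Set
IsABT {zero}        _               = ⊤
IsABT {suc zero}    _               = ⊤
IsABT {suc (suc n)} ((t , r) , r')  = IsABT {suc n} (t , r) × RowCond r r'

ABT : ℕ → Set
ABT n = [ t ∈ Tri n ∣ IsABT t ]

data Step : Set where
  E N : Step

Point : Set
Point = ℕ × ℕ

move : Point → Step → Point
move (x , y) E = (suc x , y)
move (x , y) N = (x , suc y)

points : Point → List Step → List Point
points p []       = p ∷ []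
points p (s ∷ ss) = p ∷ points (move p s) ss

endpoint : Point → List Step → Point
endpoint p []       = p
endpoint p (s ∷ ss) = endpoint (move p s) ss

start : ℕ → ℕ → Point
start n i = (n + 1 ∸ i , 1)

OnDiag : ℕ → Point → Set
OnDiag n p = Σ ℕ λ j → 1 ≤ j × j ≤ n + 1 × p ≡ (n + 2 ∸ j , j)

-- Q_i (1 ≤ i ≤ n) is  lookup Qs a  with  i = toℕ a + 1.
path : ∀ {n} → Vec (List Step) n → Fin n → List Step
path Qs a = lookup Qs a

startOf : ∀ n → Fin n → Point
startOf n a = start n (suc (toℕ a))

WeaklySE : Point → List Step → Point → List Step → Set
WeaklySE si Qi sj Qj =
  ∀ p → p ∈ points si Qi → ∀ p' → p' ∈ points sj Qj →
  proj₁ p + proj₂ p ≡ proj₁ p' + proj₂ p' → proj₁ p' ≤ proj₁ p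

IsNest : ∀ n → Vec (List Step) n → Set
IsNest n Qs =
  ((a : Fin n) → OnDiag n (endpoint (startOf n a) (path Qs a))) ×
  ((a b : Fin n) → toℕ a < toℕ b →
     WeaklySE (startOf n a) (path Qs a) (startOf n b) (path Qs b))

NCLP : ℕ → Set
NCLP n = [ Qs ∈ Vec (List Step) n ∣ IsNest n Qs ]

-- Read row i of the triangle from right to left, with 1 as a north and 0 as an east
-- step: this gives a lattice path Q_i of length i, and a path started at (n+1-i, 1)
-- ends on the diagonal D exactly when its length is i. Two paths ending on D reach
-- each shared antidiagonal with the same number of remaining steps, and Q_i lies
-- weakly southeast of Q_j iff on each of them Q_i has taken at most as many north
-- steps as Q_j. The first k steps of Q_i record A(i,i), ..., A(i,i+1-k), so for
-- j = i + 1 this is exactly the ballot inequality between rows i and i + 1. The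
-- comparison is transitive, so the consecutive conditions already give the nest.

module Submission where

open import Defs
open import Data.Nat using (ℕ; zero; suc; _+_; _∸_; _≤_; _<_; _≟_; z≤n; s≤s; z<s)
open import Data.Nat.Properties
open import Data.Nat.Tactic.RingSolver using (solve-∀)
open import Data.Nat.ListAction using (sum)
open import Data.Nat.ListAction.Properties using (sum-↭)
open import Data.Bool using (Bool; true; false)
open import Data.Unit using (tt)
open import Data.Product using (_×_; _,_; proj₁; proj₂; ∃-syntax; map₁)
open import Data.List using (List; []; _∷_; map; take; drop; reverse; length; _++_)
open import Data.List.Properties
  using (take++drop≡id; reverse-++; length-reverse; length-drop; length-map; length-take;
         take-map; drop-map; reverse-map; reverse-involutive)
open import Data.List.Relation.Binary.Permutation.Propositional.Properties using (↭-reverse)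
open import Data.List.Membership.Propositional using (_∈_)
open import Data.List.Relation.Unary.Any using (here; there)
open import Data.Vec using (Vec; []; _∷_; _∷ʳ_; toList; lookup; init; last; initLast)
open import Data.Vec.Properties using (init-∷ʳ; last-∷ʳ; length-toList)
open import Data.Vec.Relation.Unary.Linked using (Linked; []; [-]; _∷_)
open import Data.Vec.Relation.Unary.Linked.Properties using () renaming (lookup⁺ to Linked-lookup⁺)
open import Data.Fin using (Fin; zero; suc; toℕ; inject₁; fromℕ)
open import Data.Fin.Properties using (toℕ<n; toℕ-inject₁; toℕ-fromℕ)
open import Data.Irrelevant using ([_])
open import Data.Refinement using (Refinement-syntax; _,_; value-injective)
import Data.Refinement as Refinement
open import Function.Base using (_∘_)
open import Function.Bundles using (_↔_; _⇔_; mk↔ₛ′; mk⇔; Equivalence)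
open import Relation.Binary.Definitions using (Transitive)
open import Relation.Binary.PropositionalEquality
  using (_≡_; refl; sym; trans; cong; cong₂; subst; subst₂; module ≡-Reasoning)
open import Relation.Nullary.Decidable using (recompute)

open Equivalence using (to; from)

m+n≡o+p∧n≤p⇒o≤m : ∀ {m n o p} → m + n ≡ o + p → n ≤ p → o ≤ m
m+n≡o+p∧n≤p⇒o≤m {m} {n} {o} {p} eq n≤p =
  +-cancelʳ-≤ n o m (≤-trans (+-monoʳ-≤ o n≤p) (≤-reflexive (sym eq)))

m+n≡o+p∧o≤m⇒n≤p : ∀ {m n o p} → m + n ≡ o + p → o ≤ m → n ≤ p
m+n≡o+p∧o≤m⇒n≤p {m} {n} {o} {p} eq o≤m =
  +-cancelˡ-≤ o n p (≤-trans (+-monoˡ-≤ n o≤m) (≤-reflexive eq))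

m+n+o+p≡m+o+[n+p] : ∀ m n o p → m + n + o + p ≡ m + o + (n + p)
m+n+o+p≡m+o+[n+p] = solve-∀

take-length-++ : ∀ {A : Set} {k} (xs ys : List A) → length xs ≡ k → take k (xs ++ ys) ≡ xs
take-length-++ []       ys refl = refl
take-length-++ (x ∷ xs) ys refl = cong (x ∷_) (take-length-++ xs ys refl)

take-reverse : ∀ {A : Set} {k} (xs : List A) → k ≤ length xs →
               take k (reverse xs) ≡ reverse (drop (length xs ∸ k) xs)
take-reverse {k = k} xs k≤ = begin
  take k (reverse xs)                                 ≡⟨ cong (take k ∘ reverse) (take++drop≡id m xs) ⟨
  take k (reverse (take m xs ++ drop m xs))           ≡⟨ cong (take k) (reverse-++ (take m xs) (drop m xs)) ⟩
  take k (reverse (drop m xs) ++ reverse (take m xs)) ≡⟨ take-length-++ _ _ length-suffix ⟩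
  reverse (drop m xs)                                 ∎
  where
  open ≡-Reasoning
  m = length xs ∸ k
  length-suffix : length (reverse (drop m xs)) ≡ k
  length-suffix = trans (length-reverse (drop m xs)) (trans (length-drop m xs) (m∸[m∸n]≡n k≤))

pad : ∀ {A : Set} → A → (i : ℕ) → List A → Vec A i
pad a zero    _        = []
pad a (suc i) []       = a ∷ pad a i []
pad a (suc i) (x ∷ xs) = x ∷ pad a i xs

pad-toList : ∀ {A : Set} {i} (a : A) (r : Vec A i) → pad a i (toList r) ≡ r
pad-toList a []      = refl
pad-toList a (x ∷ r) = cong (x ∷_) (pad-toList a r)

toList-pad : ∀ {A : Set} (a : A) i xs → length xs ≡ i → toList (pad a i xs) ≡ xs
toList-pad a zero    []       _  = refl
toList-pad a (suc i) (x ∷ xs) eq = cong (x ∷_) (toList-pad a i xs (suc-injective eq))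

lookup-∷ʳ-inject₁ : ∀ {A : Set} {n} (xs : Vec A n) x a → lookup (xs ∷ʳ x) (inject₁ a) ≡ lookup xs a
lookup-∷ʳ-inject₁ (y ∷ xs) x zero    = refl
lookup-∷ʳ-inject₁ (y ∷ xs) x (suc a) = lookup-∷ʳ-inject₁ xs x a

lookup-∷ʳ-fromℕ : ∀ {A : Set} {n} (xs : Vec A n) x → lookup (xs ∷ʳ x) (fromℕ n) ≡ x
lookup-∷ʳ-fromℕ []       x = refl
lookup-∷ʳ-fromℕ (y ∷ xs) x = lookup-∷ʳ-fromℕ xs x

lookup-∷ʳ-elim : ∀ {A : Set} {n} (P : Fin (suc n) → A → Set) (xs : Vec A n) x →
                 (∀ a → P (inject₁ a) (lookup xs a)) → P (fromℕ n) x →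
                 ∀ b → P b (lookup (xs ∷ʳ x) b)
lookup-∷ʳ-elim P []       x _   Px zero    = Px
lookup-∷ʳ-elim P (y ∷ xs) x Pxs Px zero    = Pxs zero
lookup-∷ʳ-elim P (y ∷ xs) x Pxs Px (suc b) = lookup-∷ʳ-elim (P ∘ suc) xs x (Pxs ∘ suc) Px b

module _ {A : Set} {R : A → A → Set} where

  Linked-∷ʳ⁺ : ∀ {n} {xs : Vec A (suc n)} {y} → Linked R xs → R (last xs) y → Linked R (xs ∷ʳ y)
  Linked-∷ʳ⁺ {xs = x ∷ []}     [-]       Rxy = Rxy ∷ [-]
  Linked-∷ʳ⁺ {xs = x ∷ w ∷ ws} (Rxw ∷ l) Rxy = Rxw ∷ Linked-∷ʳ⁺ l Rxy

  Linked-∷ʳ⁻ : ∀ {n} {xs : Vec A (suc n)} {y} → Linked R (xs ∷ʳ y) → Linked R xs × R (last xs) y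
  Linked-∷ʳ⁻ {xs = x ∷ []}     (Rxy ∷ [-]) = [-] , Rxy
  Linked-∷ʳ⁻ {xs = x ∷ w ∷ ws} (Rxw ∷ l)   = map₁ (Rxw ∷_) (Linked-∷ʳ⁻ l)

  Linked-lookup⁻ : ∀ {n} {xs : Vec A n} →
                   (∀ {i j} → toℕ i < toℕ j → R (lookup xs i) (lookup xs j)) → Linked R xs
  Linked-lookup⁻ {xs = []}         _  = []
  Linked-lookup⁻ {xs = x ∷ []}     _  = [-]
  Linked-lookup⁻ {xs = x ∷ y ∷ ys} R< = R< {zero} {suc zero} z<s ∷ Linked-lookup⁻ (R< ∘ s≤s)

mk↔-Refinement : ∀ {A B : Set} {P : A → Set} {Q : B → Set} (f : A → B) (g : B → A) →
                 (∀ {x} → P x → Q (f x)) → (∀ {y} → Q y → P (g y)) →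
                 (∀ {y} → .(Q y) → f (g y) ≡ y) → (∀ {x} → .(P x) → g (f x) ≡ x) →
                 [ x ∈ A ∣ P x ] ↔ [ y ∈ B ∣ Q y ]
mk↔-Refinement f g f-P g-Q f∘g g∘f =
  mk↔ₛ′ (Refinement.map f f-P) (Refinement.map g g-Q)
        (λ { (y , [ q ]) → value-injective (f∘g q) })
        (λ { (x , [ p ]) → value-injective (g∘f p) })

-- Lattice paths

north : List Step → ℕ
north []      = 0
north (N ∷ P) = suc (north P)
north (E ∷ P) = north P

north≤length : ∀ P → north P ≤ length P
north≤length []      = z≤n
north≤length (N ∷ P) = s≤s (north≤length P)
north≤length (E ∷ P) = m≤n⇒m≤1+n (north≤length P)

diag : Point → ℕ
diag p = proj₁ p + proj₂ p

diag-endpoint : ∀ p P → diag (endpoint p P) ≡ diag p + length P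
diag-endpoint p       []      = sym (+-identityʳ (diag p))
diag-endpoint (x , y) (E ∷ P) =
  trans (diag-endpoint (suc x , y) P) (sym (+-suc (x + y) (length P)))
diag-endpoint (x , y) (N ∷ P) =
  trans (diag-endpoint (x , suc y) P)
        (trans (cong (_+ length P) (+-suc x y)) (sym (+-suc (x + y) (length P))))

proj₂-endpoint : ∀ x y P → proj₂ (endpoint (x , y) P) ≡ y + north P
proj₂-endpoint x y []      = sym (+-identityʳ y)
proj₂-endpoint x y (E ∷ P) = proj₂-endpoint (suc x) y P
proj₂-endpoint x y (N ∷ P) = trans (proj₂-endpoint x (suc y) P) (sym (+-suc y (north P)))

≡-byDiag : ∀ {p s h} → diag p ≡ s → proj₂ p ≡ h → p ≡ (s ∸ h , h)
≡-byDiag {x , y} refl refl = cong (_, y) (sym (m+n∸n≡m x y))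

∈-points⇒prefix : ∀ {p} s P → p ∈ points s P → ∃[ k ] k ≤ length P × p ≡ endpoint s (take k P)
∈-points⇒prefix s []       (here eq)  = 0 , z≤n , eq
∈-points⇒prefix s (_ ∷ _)  (here eq)  = 0 , z≤n , eq
∈-points⇒prefix s (st ∷ P) (there p∈) =
  let k , k≤ , eq = ∈-points⇒prefix (move s st) P p∈ in suc k , s≤s k≤ , eq

prefix∈points : ∀ s P {k} → k ≤ length P → endpoint s (take k P) ∈ points s P
prefix∈points s []       {zero}  _        = here refl
prefix∈points s (_ ∷ _)  {zero}  _        = here refl
prefix∈points s (st ∷ P) {suc k} (s≤s k≤) = there (prefix∈points (move s st) P k≤)

diag-prefix : ∀ p P {k} → k ≤ length P → diag (endpoint p (take k P)) ≡ diag p + k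
diag-prefix p P {k} k≤ =
  trans (diag-endpoint p (take k P)) (cong (diag p +_) (trans (length-take k P) (m≤n⇒m⊓n≡m k≤)))

-- When Q starts d columns west of P on the same row, the k-th point of P and the
-- (d + k)-th point of Q lie on the same antidiagonal; there P is weakly southeast
-- of Q iff it is weakly lower.
Below : ℕ → List Step → List Step → Set
Below d P Q = ∀ {k} → k ≤ length P → north (take k P) ≤ north (take (d + k) Q)

_≼_ : List Step → List Step → Set
P ≼ Q = ∃[ d ] d + length P ≡ length Q × Below d P Q

≼-trans : Transitive _≼_
≼-trans {P} {Q} {R} (d , lenPQ , PQ) (e , lenQR , QR) = e + d , lenPR , PR
  where
  lenPR : e + d + length P ≡ length R
  lenPR = trans (+-assoc e d (length P)) (trans (cong (e +_) lenPQ) lenQR)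
  PR : Below (e + d) P R
  PR {k} k≤ = ≤-trans (PQ k≤)
    (subst (λ m → north (take (d + k) Q) ≤ north (take m R)) (sym (+-assoc e d k))
           (QR (subst (d + k ≤_) lenPQ (+-monoʳ-≤ d k≤))))

below⇒weaklySE : ∀ {xa xb y d} P Q → xb + d ≡ xa → Below d P Q → WeaklySE (xa , y) P (xb , y) Q
below⇒weaklySE {xb = xb} {y} {d} P Q refl below _ p∈P _ p∈Q sameDiag
  with ∈-points⇒prefix _ P p∈P | ∈-points⇒prefix _ Q p∈Q
... | k , k≤ , refl | k′ , k′≤ , refl = m+n≡o+p∧n≤p⇒o≤m sameDiag heights
  where
  open ≤-Reasoning
  k′≡d+k : k′ ≡ d + k
  k′≡d+k = +-cancelˡ-≡ (xb + y) k′ (d + k) (begin-equality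
    xb + y + k′                             ≡⟨ diag-prefix (xb , y) Q k′≤ ⟨
    diag (endpoint (xb , y) (take k′ Q))    ≡⟨ sameDiag ⟨
    diag (endpoint (xb + d , y) (take k P)) ≡⟨ diag-prefix (xb + d , y) P k≤ ⟩
    xb + d + y + k                          ≡⟨ m+n+o+p≡m+o+[n+p] xb d y k ⟩
    xb + y + (d + k)                        ∎)
  heights : proj₂ (endpoint (xb + d , y) (take k P)) ≤ proj₂ (endpoint (xb , y) (take k′ Q))
  heights = begin
    proj₂ (endpoint (xb + d , y) (take k P)) ≡⟨ proj₂-endpoint (xb + d) y (take k P) ⟩
    y + north (take k P)                     ≤⟨ +-monoʳ-≤ y (below k≤) ⟩
    y + north (take (d + k) Q)               ≡⟨ cong (λ m → y + north (take m Q)) k′≡d+k ⟨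
    y + north (take k′ Q)                    ≡⟨ proj₂-endpoint xb y (take k′ Q) ⟨
    proj₂ (endpoint (xb , y) (take k′ Q))    ∎

weaklySE⇒below : ∀ {xa xb y d} P Q → xb + d ≡ xa → d + length P ≤ length Q →
                 WeaklySE (xa , y) P (xb , y) Q → Below d P Q
weaklySE⇒below {xb = xb} {y} {d} P Q refl fits southeast {k} k≤ = +-cancelˡ-≤ y _ _ (begin
    y + north (take k P)       ≡⟨ proj₂-endpoint (xb + d) y (take k P) ⟨
    proj₂ p                    ≤⟨ m+n≡o+p∧o≤m⇒n≤p sameDiag
                                    (southeast p (prefix∈points _ P k≤) q (prefix∈points _ Q d+k≤) sameDiag) ⟩
    proj₂ q                    ≡⟨ proj₂-endpoint xb y (take (d + k) Q) ⟩
    y + north (take (d + k) Q) ∎)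
  where
  open ≤-Reasoning
  p = endpoint (xb + d , y) (take k P)
  q = endpoint (xb , y) (take (d + k) Q)
  d+k≤ : d + k ≤ length Q
  d+k≤ = ≤-trans (+-monoʳ-≤ d k≤) fits
  sameDiag : diag p ≡ diag q
  sameDiag = begin-equality
    diag p           ≡⟨ diag-prefix (xb + d , y) P k≤ ⟩
    xb + d + y + k   ≡⟨ m+n+o+p≡m+o+[n+p] xb d y k ⟩
    xb + y + (d + k) ≡⟨ diag-prefix (xb , y) Q d+k≤ ⟨
    diag q           ∎

start-offset : ∀ {xa xb d m n} → xa + m ≡ xb + n → d + m ≡ n → xb + d ≡ xa
start-offset {xa} {xb} {d} {m} {n} ends len = +-cancelʳ-≡ m (xb + d) xa (begin
  xb + d + m   ≡⟨ +-assoc xb d m ⟩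
  xb + (d + m) ≡⟨ cong (xb +_) len ⟩
  xb + n       ≡⟨ ends ⟨
  xa + m       ∎)
  where open ≡-Reasoning

weaklySE⇔≼ : ∀ {xa xb y} P Q → xa + length P ≡ xb + length Q → length P ≤ length Q →
             WeaklySE (xa , y) P (xb , y) Q ⇔ P ≼ Q
weaklySE⇔≼ P Q ends P≤Q = mk⇔ southeast⇒≼ ≼⇒southeast
  where
  southeast⇒≼ : WeaklySE _ P _ Q → P ≼ Q
  southeast⇒≼ southeast = length Q ∸ length P , len ,
    weaklySE⇒below P Q (start-offset ends len) (≤-reflexive len) southeast
    where len = m∸n+n≡m P≤Q
  ≼⇒southeast : P ≼ Q → WeaklySE _ P _ Q
  ≼⇒southeast (d , len , below) = below⇒weaklySE P Q (start-offset ends len) below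

onDiag⇔ : ∀ {n x} P → 1 ≤ x → OnDiag n (endpoint (x , 1) P) ⇔ x + length P ≡ n + 1
onDiag⇔ {n} {x} P 1≤x = mk⇔ onDiag⇒ ⇒onDiag
  where
  open ≡-Reasoning
  diag≡ : diag (endpoint (x , 1) P) ≡ suc (x + length P)
  diag≡ = trans (diag-endpoint (x , 1) P) (trans (+-assoc x 1 (length P)) (+-suc x (length P)))
  onDiag⇒ : OnDiag n (endpoint (x , 1) P) → x + length P ≡ n + 1
  onDiag⇒ (j , _ , j≤ , onD) = suc-injective (begin
    suc (x + length P)        ≡⟨ diag≡ ⟨
    diag (endpoint (x , 1) P) ≡⟨ cong diag onD ⟩
    n + 2 ∸ j + j             ≡⟨ m∸n+n≡m (≤-trans j≤ (+-monoʳ-≤ n (n≤1+n 1))) ⟩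
    n + 2                     ≡⟨ +-suc n 1 ⟩
    suc (n + 1)               ∎)
  ⇒onDiag : x + length P ≡ n + 1 → OnDiag n (endpoint (x , 1) P)
  ⇒onDiag ends =
    suc (north P) , s≤s z≤n ,
    ≤-trans (+-mono-≤ 1≤x (north≤length P)) (≤-reflexive ends) ,
    ≡-byDiag (trans diag≡ (trans (cong suc ends) (sym (+-suc n 1)))) (proj₂-endpoint x 1 P)

-- Rows of a triangle as lattice paths

toStep : Bool → Step
toStep true  = N
toStep false = E

isNorth : Step → Bool
isNorth N = true
isNorth E = false

map-isNorth-toStep : ∀ bs → map isNorth (map toStep bs) ≡ bs
map-isNorth-toStep []           = refl
map-isNorth-toStep (true ∷ bs)  = cong (true ∷_) (map-isNorth-toStep bs)
map-isNorth-toStep (false ∷ bs) = cong (false ∷_) (map-isNorth-toStep bs)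

map-toStep-isNorth : ∀ P → map toStep (map isNorth P) ≡ P
map-toStep-isNorth []      = refl
map-toStep-isNorth (N ∷ P) = cong (N ∷_) (map-toStep-isNorth P)
map-toStep-isNorth (E ∷ P) = cong (E ∷_) (map-toStep-isNorth P)

north-map-toStep : ∀ bs → north (map toStep bs) ≡ sum (map b2n bs)
north-map-toStep []           = refl
north-map-toStep (true ∷ bs)  = cong suc (north-map-toStep bs)
north-map-toStep (false ∷ bs) = north-map-toStep bs

rowPath : ∀ {i} → Vec Bool i → List Step
rowPath r = map toStep (reverse (toList r))

pathRow : (i : ℕ) → List Step → Vec Bool i
pathRow i P = pad false i (reverse (map isNorth P))

length-rowPath : ∀ {i} (r : Vec Bool i) → length (rowPath r) ≡ i
length-rowPath r =
  trans (length-map toStep (reverse (toList r)))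
        (trans (length-reverse (toList r)) (length-toList r))

pathRow-rowPath : ∀ {i} (r : Vec Bool i) → pathRow i (rowPath r) ≡ r
pathRow-rowPath {i} r = begin
  pad false i (reverse (map isNorth (map toStep (reverse (toList r))))) ≡⟨ cong (pad false i ∘ reverse) (map-isNorth-toStep (reverse (toList r))) ⟩
  pad false i (reverse (reverse (toList r)))                           ≡⟨ cong (pad false i) (reverse-involutive (toList r)) ⟩
  pad false i (toList r)                                               ≡⟨ pad-toList false r ⟩
  r                                                                    ∎
  where open ≡-Reasoning

rowPath-pathRow : ∀ {i} P → length P ≡ i → rowPath (pathRow i P) ≡ P
rowPath-pathRow {i} P len = begin
  map toStep (reverse (toList (pad false i (reverse (map isNorth P))))) ≡⟨ cong (map toStep ∘ reverse) (toList-pad false i _ len′) ⟩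
  map toStep (reverse (reverse (map isNorth P)))                       ≡⟨ cong (map toStep) (reverse-involutive (map isNorth P)) ⟩
  map toStep (map isNorth P)                                           ≡⟨ map-toStep-isNorth P ⟩
  P                                                                    ∎
  where
  open ≡-Reasoning
  len′ : length (reverse (map isNorth P)) ≡ i
  len′ = trans (length-reverse (map isNorth P)) (trans (length-map isNorth P) len)

north-take-rowPath : ∀ {i k} (r : Vec Bool i) → k ≤ i →
                     north (take k (rowPath r)) ≡ sum (drop (i ∸ k) (map b2n (toList r)))
north-take-rowPath {i} {k} r k≤i = begin
  north (take k (map toStep (reverse bs)))   ≡⟨ cong north (take-map k (reverse bs)) ⟩
  north (map toStep (take k (reverse bs)))   ≡⟨ north-map-toStep (take k (reverse bs)) ⟩
  sum (map b2n (take k (reverse bs)))        ≡⟨ cong (sum ∘ map b2n) (take-reverse bs k≤) ⟩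
  sum (map b2n (reverse (drop m bs)))        ≡⟨ cong sum (reverse-map b2n (drop m bs)) ⟩
  sum (reverse (map b2n (drop m bs)))        ≡⟨ sum-↭ (↭-reverse (map b2n (drop m bs))) ⟩
  sum (map b2n (drop m bs))                  ≡⟨ cong sum (drop-map m bs) ⟨
  sum (drop m (map b2n bs))                  ≡⟨ cong (λ l → sum (drop (l ∸ k) (map b2n bs))) (length-toList r) ⟩
  sum (drop (i ∸ k) (map b2n bs))            ∎
  where
  open ≡-Reasoning
  bs = toList r
  m = length bs ∸ k
  k≤ : k ≤ length bs
  k≤ = subst (k ≤_) (sym (length-toList r)) k≤i

RowCond⇒Below : ∀ {i} (r : Vec Bool i) r′ → RowCond r r′ → Below 1 (rowPath r) (rowPath r′)
RowCond⇒Below     r r′ rowCond {zero}  _    = z≤n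
RowCond⇒Below {i} r r′ rowCond {suc k} k<i′ = begin
  north (take (suc k) (rowPath r))             ≡⟨ north-take-rowPath r k<i ⟩
  sum (drop (i ∸ suc k) (map b2n (toList r)))  ≤⟨ rowCond (suc (i ∸ suc k)) (s≤s z≤n) (∸-monoʳ-< z<s k<i) ⟩
  sum (drop (i ∸ suc k) (map b2n (toList r′))) ≡⟨ north-take-rowPath r′ (s≤s k<i) ⟨
  north (take (suc (suc k)) (rowPath r′))      ∎
  where
  open ≤-Reasoning
  k<i : suc k ≤ i
  k<i = subst (suc k ≤_) (length-rowPath r) k<i′

Below⇒RowCond : ∀ {i} (r : Vec Bool i) r′ → Below 1 (rowPath r) (rowPath r′) → RowCond r r′
Below⇒RowCond {i} r r′ below (suc j) _ j<i = begin
  sum (drop j (map b2n (toList r)))               ≡⟨ cong (λ m → sum (drop m (map b2n (toList r)))) i∸[i∸j]≡j ⟨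
  sum (drop (i ∸ (i ∸ j)) (map b2n (toList r)))   ≡⟨ north-take-rowPath r (m∸n≤m i j) ⟨
  north (take (i ∸ j) (rowPath r))                ≤⟨ below (subst (i ∸ j ≤_) (sym (length-rowPath r)) (m∸n≤m i j)) ⟩
  north (take (suc (i ∸ j)) (rowPath r′))         ≡⟨ north-take-rowPath r′ (s≤s (m∸n≤m i j)) ⟩
  sum (drop (i ∸ (i ∸ j)) (map b2n (toList r′)))  ≡⟨ cong (λ m → sum (drop m (map b2n (toList r′)))) i∸[i∸j]≡j ⟩
  sum (drop j (map b2n (toList r′)))              ∎
  where
  open ≤-Reasoning
  i∸[i∸j]≡j : i ∸ (i ∸ j) ≡ j
  i∸[i∸j]≡j = m∸[m∸n]≡n (<⇒≤ j<i)

RowCond⇔≼ : ∀ {i} (r : Vec Bool i) r′ → RowCond r r′ ⇔ rowPath r ≼ rowPath r′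
RowCond⇔≼ {i} r r′ = mk⇔ (λ rowCond → 1 , len , RowCond⇒Below r r′ rowCond) ≼⇒RowCond
  where
  len : 1 + length (rowPath r) ≡ length (rowPath r′)
  len = trans (cong suc (length-rowPath r)) (sym (length-rowPath r′))
  ≼⇒RowCond : rowPath r ≼ rowPath r′ → RowCond r r′
  ≼⇒RowCond (d , lenᵈ , below) = Below⇒RowCond r r′ (subst (λ e → Below e _ _) d≡1 below)
    where
    d≡1 : d ≡ 1
    d≡1 = +-cancelʳ-≡ i d 1 (trans (cong (d +_) (sym (length-rowPath r))) (trans lenᵈ (length-rowPath r′)))

-- Triangles as vectors of paths

paths : ∀ {n} → Tri n → Vec (List Step) n
paths {zero}  _       = []
paths {suc n} (t , r) = paths t ∷ʳ rowPath r

triangle : ∀ {n} → Vec (List Step) n → Tri n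
triangle {zero}  _ = tt
triangle {suc n} v = triangle (init v) , pathRow (suc n) (last v)

triangle-paths : ∀ {n} (t : Tri n) → triangle (paths t) ≡ t
triangle-paths {zero}  _       = refl
triangle-paths {suc n} (t , r) = cong₂ _,_
  (trans (cong triangle (init-∷ʳ (rowPath r) (paths t))) (triangle-paths t))
  (trans (cong (pathRow (suc n)) (last-∷ʳ (rowPath r) (paths t))) (pathRow-rowPath r))

Sized : ∀ {n} → Vec (List Step) n → Set
Sized v = ∀ a → length (lookup v a) ≡ suc (toℕ a)

-- The nest property is only available as an irrelevant proof inside NCLP.
recomputeSized : ∀ {n} (v : Vec (List Step) n) → .(Sized v) → Sized v
recomputeSized v sized a = recompute (length (lookup v a) ≟ suc (toℕ a)) (sized a)

Sized-∷ʳ⁺ : ∀ {n} (xs : Vec (List Step) n) x → Sized xs → length x ≡ suc n → Sized (xs ∷ʳ x)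
Sized-∷ʳ⁺ {n} xs x sized len = lookup-∷ʳ-elim (λ b P → length P ≡ suc (toℕ b)) xs x
  (λ a → trans (sized a) (cong suc (sym (toℕ-inject₁ a))))
  (trans len (cong suc (sym (toℕ-fromℕ n))))

Sized-∷ʳ⁻ : ∀ {n} (xs : Vec (List Step) n) x → Sized (xs ∷ʳ x) → Sized xs × length x ≡ suc n
Sized-∷ʳ⁻ {n} xs x sized =
  (λ a → trans (cong length (sym (lookup-∷ʳ-inject₁ xs x a)))
               (trans (sized (inject₁ a)) (cong suc (toℕ-inject₁ a)))) ,
  trans (cong length (sym (lookup-∷ʳ-fromℕ xs x))) (trans (sized (fromℕ n)) (cong suc (toℕ-fromℕ n)))

Sized-paths : ∀ {n} (t : Tri n) → Sized (paths t)
Sized-paths {zero}  _       ()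
Sized-paths {suc n} (t , r) = Sized-∷ʳ⁺ (paths t) (rowPath r) (Sized-paths t) (length-rowPath r)

paths-triangle : ∀ {n} (v : Vec (List Step) n) → Sized v → paths (triangle v) ≡ v
paths-triangle {zero}  []    _     = refl
paths-triangle {suc n} v     sized = begin
  paths (triangle (init v)) ∷ʳ rowPath (pathRow (suc n) (last v))
    ≡⟨ cong₂ _∷ʳ_ (paths-triangle (init v) (proj₁ sized∷ʳ)) (rowPath-pathRow (last v) (proj₂ sized∷ʳ)) ⟩
  init v ∷ʳ last v
    ≡⟨ v≡init∷ʳlast ⟨
  v ∎
  where
  open ≡-Reasoning
  v≡init∷ʳlast : v ≡ init v ∷ʳ last v
  v≡init∷ʳlast = proj₂ (proj₂ (initLast v))
  sized∷ʳ = Sized-∷ʳ⁻ (init v) (last v) (subst Sized v≡init∷ʳlast sized)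

IsABT⇒Linked : ∀ {n} (t : Tri n) → IsABT t → Linked _≼_ (paths t)
IsABT⇒Linked {zero}        _              _               = []
IsABT⇒Linked {suc zero}    _              _               = [-]
IsABT⇒Linked {suc (suc n)} ((t , r) , r′) (abt , rowCond) =
  Linked-∷ʳ⁺ (IsABT⇒Linked (t , r) abt)
    (subst (_≼ rowPath r′) (sym (last-∷ʳ (rowPath r) (paths t))) (to (RowCond⇔≼ r r′) rowCond))

Linked⇒IsABT : ∀ {n} (t : Tri n) → Linked _≼_ (paths t) → IsABT t
Linked⇒IsABT {zero}        _              _      = tt
Linked⇒IsABT {suc zero}    _              _      = tt
Linked⇒IsABT {suc (suc n)} ((t , r) , r′) linked =
  Linked⇒IsABT (t , r) (proj₁ split) ,
  from (RowCond⇔≼ r r′) (subst (_≼ rowPath r′) (last-∷ʳ (rowPath r) (paths t)) (proj₂ split))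
  where split = Linked-∷ʳ⁻ linked

-- Nests

startOf-ends : ∀ n (a : Fin n) → proj₁ (startOf n a) + suc (toℕ a) ≡ n + 1
startOf-ends n a = m∸n+n≡m (≤-trans (toℕ<n a) (m≤m+n n 1))

startOf-onDiag⇔ : ∀ n (a : Fin n) P → OnDiag n (endpoint (startOf n a) P) ⇔ length P ≡ suc (toℕ a)
startOf-onDiag⇔ n a P = mk⇔
  (λ onDiag → +-cancelˡ-≡ x _ _ (trans (to ends⇔ onDiag) (sym (startOf-ends n a))))
  (λ len → from ends⇔ (trans (cong (x +_) len) (startOf-ends n a)))
  where
  x = proj₁ (startOf n a)
  ends⇔ = onDiag⇔ P (m<n⇒0<n∸m (≤-trans (s≤s (toℕ<n a)) (≤-reflexive (+-comm 1 n))))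

IsNest⇔ : ∀ n (v : Vec (List Step) n) → IsNest n v ⇔ (Sized v × Linked _≼_ v)
IsNest⇔ n v = mk⇔
  (λ (onDiag , southeast) →
     let sized a = to (startOf-onDiag⇔ n a (lookup v a)) (onDiag a)
     in sized , Linked-lookup⁻ (λ a<b → to (pair⇔ sized a<b) (southeast _ _ a<b)))
  (λ (sized , linked) →
     (λ a → from (startOf-onDiag⇔ n a (lookup v a)) (sized a)) ,
     (λ a b a<b → from (pair⇔ sized a<b) (Linked-lookup⁺ ≼-trans linked a<b)))
  where
  pair⇔ : Sized v → ∀ {a b} → toℕ a < toℕ b →
          WeaklySE (startOf n a) (lookup v a) (startOf n b) (lookup v b) ⇔ lookup v a ≼ lookup v b
  pair⇔ sized {a} {b} a<b = weaklySE⇔≼ (lookup v a) (lookup v b)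
    (trans (cong (_ +_) (sized a))
           (trans (startOf-ends n a) (sym (trans (cong (_ +_) (sized b)) (startOf-ends n b)))))
    (subst₂ _≤_ (sym (sized a)) (sym (sized b)) (s≤s (<⇒≤ a<b)))

IsABT⇒IsNest : ∀ {n} (t : Tri n) → IsABT t → IsNest n (paths t)
IsABT⇒IsNest {n} t abt = from (IsNest⇔ n (paths t)) (Sized-paths t , IsABT⇒Linked t abt)

IsNest⇒IsABT : ∀ {n} (v : Vec (List Step) n) → IsNest n v → IsABT (triangle v)
IsNest⇒IsABT {n} v nest =
  Linked⇒IsABT (triangle v) (subst (Linked _≼_) (sym (paths-triangle v sized)) linked)
  where
  sized×linked = to (IsNest⇔ n v) nest
  sized = proj₁ sized×linked
  linked = proj₂ sized×linked

proposition3p3 : (n : ℕ) → 1 ≤ n → ABT n ↔ NCLP n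
proposition3p3 n _ = mk↔-Refinement paths triangle
  (IsABT⇒IsNest _)
  (IsNest⇒IsABT _)
  (λ {v} nest → paths-triangle v (recomputeSized v (proj₁ (to (IsNest⇔ n v) nest))))
  (λ {t} _ → triangle-paths t)
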